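{- Let $G$ be a connected simple graph with $n\ge3$ vertices and $2n-3$ edges, and let $c:E(G)\to[n-1]$ be a colouring with $|c^{ -1}(1)|=1$ and $|c^{ -1}(i)|=2$ for $i=2,\dots,n-1$, such that $G$ has no rainbow cycle. Let $u_1,u_2,u_1',u_2'$ be vertices of $G$ which are distinct except possibly $u_1=u_2$. If $u=u_1=u_2$, then there are edge-disjoint rainbow paths $P_1,P_2$ in $G$, $P_i$ from $u$ to $u_i'$, with $|P_1|+|P_2|\le n-1$. If $u_1\ne u_2$, then there are edge-disjoint rainbow paths $P_1,P_2$ in $G$ originating at distinct vertices of $\{u_1,u_2\}$ and terminating at distinct vertices of $\{u_1',u_2'\}$, with $|P_1|+|P_2|\le n-2$.
   Context: A path is rainbow if its edges have pairwise distinct colours; $|P|$ is the number of edges of $P$. -}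

module Defs where

open import Data.Nat using (ℕ; suc; _≤_; _≟_)
open import Data.Fin using (Fin)
open import Data.List using (List; []; _∷_; map; length; filter; allFin)
open import Data.List.Membership.Propositional using (_∈_)
open import Data.List.Relation.Unary.Unique.Propositional using (Unique)
open import Data.Product using (Σ; _×_; _,_; proj₁; proj₂; ∃)
open import Data.Sum using (_⊎_)
open import Data.Empty using (⊥)
open import Relation.Binary.PropositionalEquality using (_≡_; _≢_)

-- A finite graph on vertex set Fin n with m edges indexed by Fin m;
-- `ends e` gives the two endpoints of edge e (order irrelevant).
record Graph (n m : ℕ) : Set where
  field
    ends : Fin m → Fin n × Fin n

open Graph public

Joins : ∀ {n m} → Graph n m → Fin m → Fin n → Fin n → Set
Joins G e u w = ends G e ≡ (u , w) ⊎ ends G e ≡ (w , u)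

Simple : ∀ {n m} → Graph n m → Set
Simple {n} {m} G =
  (∀ (e : Fin m) → proj₁ (ends G e) ≢ proj₂ (ends G e)) ×
  (∀ (e f : Fin m) (u w : Fin n) → Joins G e u w → Joins G f u w → e ≡ f)

data Walk {n m} (G : Graph n m) : Fin n → Fin n → List (Fin n) → List (Fin m) → Set where
  here : ∀ {u} → Walk G u u (u ∷ []) []
  step : ∀ {u w v vs es} (e : Fin m) → Joins G e u w → Walk G w v vs es →
         Walk G u v (u ∷ vs) (e ∷ es)

Path : ∀ {n m} → Graph n m → Fin n → Fin n → List (Fin m) → Set
Path {n} G u v es = Σ (List (Fin n)) λ vs → Walk G u v vs es × Unique vs

Connected : ∀ {n m} → Graph n m → Set
Connected {n} {m} G = ∀ (u v : Fin n) → Σ (List (Fin m)) λ es → Path G u v es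

Rainbow : ∀ {m} → (Fin m → ℕ) → List (Fin m) → Set
Rainbow c es = Unique (map c es)

EdgeDisjoint : ∀ {m} → List (Fin m) → List (Fin m) → Set
EdgeDisjoint {m} es fs = ∀ (e : Fin m) → e ∈ es → e ∈ fs → ⊥

-- G has a rainbow cycle: an edge e between u and w together with a path
-- from w back to u, of total length ≥ 3, all edge colours distinct
HasRainbowCycle : ∀ {n m} → Graph n m → (Fin m → ℕ) → Set
HasRainbowCycle {n} {m} G c =
  Σ (Fin n) λ u → Σ (Fin n) λ w → Σ (Fin m) λ e → Σ (List (Fin m)) λ es →
    Joins G e u w × Path G w u es × 3 ≤ suc (length es) × Rainbow c (e ∷ es)

colourCount : ∀ {m} → (Fin m → ℕ) → ℕ → ℕ
colourCount {m} c i = length (filter (λ e → c e ≟ i) (allFin m))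

{-# OPTIONS --safe #-}
-- Let e₀ be the edge of colour 1, and call v the centre of a colour i ≥ 2 when both edges of
-- colour i meet v; as G is simple, each colour has at most one centre. A rainbow set of edges
-- spanning no more vertices than it has edges contains a rainbow cycle (strip vertices of
-- degree ≤ 1, then walk without ever reusing the edge just traversed). Hence every vertex v off
-- e₀ is a centre: otherwise e₀ and one edge of each colour 2, …, n − 1 avoiding v would be
-- n − 1 rainbow edges on the n − 1 other vertices.
--
-- Grow A from the ends of e₀, each time adding a vertex v ∉ A whose two centre edges both end
-- in A. This never gets stuck: otherwise every vertex outside A has a centre edge leaving A, and
-- these are as many rainbow edges as there are vertices outside A. Using only the colours added
-- so far, A keeps the required systems of edge-disjoint rainbow paths between its vertices, of
-- total length at most |A| − 1 for a common source and |A| − 2 for two sources. Adding v raises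
-- the budget by one, which pays for routing a path through one of the two new edges; their
-- colour is fresh, so rainbowness and disjointness survive.
module Submission where

open import Defs
open import Data.Nat using (ℕ; zero; suc; _+_; _*_; _∸_; _≤_; _<_; z≤n; s≤s; _≤?_) renaming (_≟_ to _≟ℕ_)
open import Data.Nat.Properties
  using (+-suc; +-comm; +-cancelˡ-≡; +-monoˡ-≤; ≤-refl; ≤-reflexive; ≤-trans; ≤-pred; m≤n⇒m≤1+n; m<m+n; <⇒≱; ≰⇒>;
         module ≤-Reasoning)
open import Data.Fin using (Fin; toℕ) renaming (_≟_ to _≟ᶠ_)
open import Data.Fin.Properties using (toℕ-injective; toℕ<n; ¬∀⟶∃¬) renaming (any? to anyᶠ?; all? to allᶠ?)
open import Data.List using (List; []; _∷_; _++_; _∷ʳ_; length; map; filter; head; allFin; tabulate)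
open import Data.List.Properties using (length-++; map-++; filter-notAll; length-tabulate; map-tabulate)
open import Data.List.Membership.Propositional using (_∈_; _∉_; find; lose)
open import Data.List.Membership.Propositional.Properties
  using (∈-filter⁺; ∈-filter⁻; ∈-map⁺; ∈-++⁻; ∈-++⁺ˡ; ∈-length; ∈-allFin)
open import Data.List.Relation.Binary.Subset.Propositional using (_⊆_)
open import Data.List.Relation.Binary.Subset.Propositional.Properties using (∷⁺ʳ; ∈-∷⁺ʳ; filter-⊆)
open import Data.List.Relation.Unary.Any as Any using (Any; here; there; any?)
open import Data.List.Relation.Unary.All as All using (All; []; _∷_; all?)
open import Data.List.Relation.Unary.AllPairs using ([]; _∷_)
open import Data.List.Relation.Unary.Unique.Propositional using (Unique)
import Data.List.Relation.Unary.Unique.Propositional.Properties as Unique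
import Data.List.Relation.Unary.All.Properties as Allₚ
open import Data.List.Relation.Unary.All.Properties using (¬All⇒Any¬)
open import Data.Maybe using (Maybe; just; nothing)
open import Data.Maybe.Properties using (just-injective)
open import Data.Product using (Σ; ∃; ∃₂; _×_; _,_; proj₁; proj₂)
open import Data.Product.Properties using (,-injective)
open import Data.Sum using (_⊎_; inj₁; inj₂)
import Data.Sum as Sum
open import Data.Empty using (⊥; ⊥-elim)
open import Function using (_∘_; id)
open import Relation.Nullary using (¬_; Dec; yes; no)
open import Relation.Nullary.Decidable using (¬?; _⊎-dec_)
open import Relation.Binary.Definitions using (DecidableEquality)
open import Relation.Unary using (Decidable)
open import Relation.Unary.Properties using (∁?)
open import Relation.Binary.PropositionalEquality

length-filter-≢ : ∀ {a} {A : Set a} (_≟_ : DecidableEquality A) {x xs} → x ∈ xs →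
                  length (filter (λ y → ¬? (y ≟ x)) xs) < length xs
length-filter-≢ _≟_ {x} {xs} x∈xs = filter-notAll (λ y → ¬? (y ≟ x)) xs (Any.map (λ { refl x≢x → x≢x refl }) x∈xs)

unique⊆⇒length≤ : ∀ {a} {A : Set a} → DecidableEquality A →
                  {xs ys : List A} → Unique xs → xs ⊆ ys → length xs ≤ length ys
unique⊆⇒length≤ _≟_ {[]} _ _ = z≤n
unique⊆⇒length≤ _≟_ {x ∷ xs} {ys} (x∉xs ∷ xs!) xs⊆ys =
  ≤-trans (s≤s (unique⊆⇒length≤ _≟_ xs! xs⊆ys-x)) (length-filter-≢ _≟_ (xs⊆ys (here refl)))
  where
  xs⊆ys-x : xs ⊆ filter (λ y → ¬? (y ≟ x)) ys
  xs⊆ys-x z∈xs = ∈-filter⁺ (λ y → ¬? (y ≟ x)) (xs⊆ys (there z∈xs)) λ z≡x → All.lookup x∉xs z∈xs (sym z≡x)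

nonempty⇒∈ : ∀ {a} {A : Set a} {xs : List A} → 0 < length xs → ∃ λ x → x ∈ xs
nonempty⇒∈ {xs = x ∷ _} _ = x , here refl

module _ {a b} {A : Set a} {B : Set b} (f : A → B) where

  unique-map⇒injectiveOn : ∀ {xs} → Unique (map f xs) →
                           ∀ {x y} → x ∈ xs → y ∈ xs → f x ≡ f y → x ≡ y
  unique-map⇒injectiveOn _ (here refl) (here refl) _ = refl
  unique-map⇒injectiveOn (fx∉ ∷ _) (here refl) (there y∈) fx≡fy = ⊥-elim (All.lookup fx∉ (∈-map⁺ f y∈) fx≡fy)
  unique-map⇒injectiveOn (fy∉ ∷ _) (there x∈) (here refl) fx≡fy = ⊥-elim (All.lookup fy∉ (∈-map⁺ f x∈) (sym fx≡fy))
  unique-map⇒injectiveOn (_ ∷ u) (there x∈) (there y∈) fx≡fy = unique-map⇒injectiveOn u x∈ y∈ fx≡fy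

  unique-map-⊆ : ∀ {xs ys} → Unique (map f ys) → xs ⊆ ys → Unique xs → Unique (map f xs)
  unique-map-⊆ _ _ [] = []
  unique-map-⊆ {x ∷ xs} u xs⊆ys (x∉ ∷ xs!) =
    Allₚ.map⁺ (All.tabulate λ z∈ fx≡fz →
                 All.lookup x∉ z∈ (unique-map⇒injectiveOn u (xs⊆ys (here refl)) (xs⊆ys (there z∈)) fx≡fz))
    ∷ unique-map-⊆ u (xs⊆ys ∘ there) xs!

length-filter-∁ : ∀ {a p} {A : Set a} {P : A → Set p} (P? : Decidable P) (xs : List A) →
                  length (filter P? xs) + length (filter (∁? P?) xs) ≡ length xs
length-filter-∁ P? [] = refl
length-filter-∁ P? (x ∷ xs) with P? x
... | yes _ = cong suc (length-filter-∁ P? xs)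
... | no _ = trans (+-suc _ _) (cong suc (length-filter-∁ P? xs))

two-distinct : ∀ {a} {A : Set a} {xs : List A} → Unique xs → 1 < length xs →
               ∃₂ λ x y → x ∈ xs × y ∈ xs × x ≢ y
two-distinct {xs = _ ∷ _ ∷ _} ((x≢y ∷ _) ∷ _) _ = _ , _ , here refl , there (here refl) , x≢y
two-distinct {xs = _ ∷ []} _ (s≤s ())

length-∷ʳ : ∀ {a} {A : Set a} (xs : List A) x → length (xs ∷ʳ x) ≡ suc (length xs)
length-∷ʳ xs x = trans (length-++ xs) (+-comm (length xs) 1)

∷ʳ-⊆ : ∀ {a} {A : Set a} {x : A} {xs ys} → xs ⊆ ys → xs ∷ʳ x ⊆ x ∷ ys
∷ʳ-⊆ {xs = xs} xs⊆ys y∈ with ∈-++⁻ xs y∈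
... | inj₁ y∈xs = there (xs⊆ys y∈xs)
... | inj₂ (here refl) = here refl

∷ʳ-unique : ∀ {a} {A : Set a} {x : A} {xs} → Unique xs → All (x ≢_) xs → Unique (xs ∷ʳ x)
∷ʳ-unique xs! x∉ = Unique.++⁺ xs! ([] ∷ []) λ { (y∈ , here refl) → All.lookup x∉ y∈ refl }

module _ {m : ℕ} where

  []-disjoint : ∀ {Q} → EdgeDisjoint {m} [] Q
  []-disjoint _ () _

  disjoint-sym : ∀ {Q₁ Q₂} → EdgeDisjoint {m} Q₁ Q₂ → EdgeDisjoint Q₂ Q₁
  disjoint-sym d e e∈Q₂ e∈Q₁ = d e e∈Q₁ e∈Q₂

  ∷-disjoint : ∀ {e Q₁ Q₂} → e ∉ Q₂ → EdgeDisjoint {m} Q₁ Q₂ → EdgeDisjoint (e ∷ Q₁) Q₂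
  ∷-disjoint e∉ _ _ (here refl) = e∉
  ∷-disjoint _ d f (there f∈) = d f f∈

  ∷ʳ-disjoint : ∀ {e Q₁ Q₂} → e ∉ Q₂ → EdgeDisjoint {m} Q₁ Q₂ → EdgeDisjoint (Q₁ ∷ʳ e) Q₂
  ∷ʳ-disjoint {Q₁ = Q₁} e∉ d f f∈ with ∈-++⁻ Q₁ f∈
  ... | inj₁ f∈Q₁ = d f f∈Q₁
  ... | inj₂ (here refl) = e∉

module GraphFacts {n m : ℕ} (G : Graph n m) where

  joins-sym : ∀ {e u w} → Joins G e u w → Joins G e w u
  joins-sym (inj₁ eq) = inj₂ eq
  joins-sym (inj₂ eq) = inj₁ eq

  joins-endpoints : ∀ {e a b u w} → Joins G e a b → Joins G e u w →
                    (a ≡ u × b ≡ w) ⊎ (a ≡ w × b ≡ u)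
  joins-endpoints (inj₁ p) (inj₁ q) = inj₁ (,-injective (trans (sym p) q))
  joins-endpoints (inj₁ p) (inj₂ q) = inj₂ (,-injective (trans (sym p) q))
  joins-endpoints (inj₂ p) (inj₁ q) = let a≡w , b≡u = ,-injective (trans (sym p) q) in inj₂ (b≡u , a≡w)
  joins-endpoints (inj₂ p) (inj₂ q) = let a≡u , b≡w = ,-injective (trans (sym p) q) in inj₁ (b≡w , a≡u)

  walk-∷ʳ : ∀ {u p v vs es e} → Walk G u p vs es → Joins G e p v → Walk G u v (vs ∷ʳ v) (es ∷ʳ e)
  walk-∷ʳ here j = step _ j here
  walk-∷ʳ (step f j w) j' = step f j (walk-∷ʳ w j')

  Incident : Fin n → Fin m → Set
  Incident x e = proj₁ (ends G e) ≡ x ⊎ proj₂ (ends G e) ≡ x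

  incident? : ∀ x e → Dec (Incident x e)
  incident? x e = (proj₁ (ends G e) ≟ᶠ x) ⊎-dec (proj₂ (ends G e) ≟ᶠ x)

  incident⇒joins : ∀ {x e} → Incident x e → ∃ (Joins G e x)
  incident⇒joins {e = e} (inj₁ refl) = proj₂ (ends G e) , inj₁ refl
  incident⇒joins {e = e} (inj₂ refl) = proj₁ (ends G e) , inj₂ refl

  joins⇒incident : ∀ {e x y} → Joins G e x y → Incident x e × Incident y e
  joins⇒incident (inj₁ refl) = inj₁ refl , inj₂ refl
  joins⇒incident (inj₂ refl) = inj₂ refl , inj₁ refl

  incidents⇒joins : ∀ {e v w} → Incident v e → Incident w e → v ≢ w → Joins G e v w
  incidents⇒joins (inj₁ refl) (inj₁ refl) v≢w = ⊥-elim (v≢w refl)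
  incidents⇒joins (inj₁ refl) (inj₂ refl) _ = inj₁ refl
  incidents⇒joins (inj₂ refl) (inj₁ refl) _ = inj₂ refl
  incidents⇒joins (inj₂ refl) (inj₂ refl) v≢w = ⊥-elim (v≢w refl)

  EdgeWithin : List (Fin n) → Fin m → Set
  EdgeWithin W e = proj₁ (ends G e) ∈ W × proj₂ (ends G e) ∈ W

  joins⇒within : ∀ {W e x y} → Joins G e x y → x ∈ W → y ∈ W → EdgeWithin W e
  joins⇒within (inj₁ refl) x∈ y∈ = x∈ , y∈
  joins⇒within (inj₂ refl) x∈ y∈ = y∈ , x∈

  within-incident⇒∈ : ∀ {W e y} → EdgeWithin W e → Incident y e → y ∈ W
  within-incident⇒∈ (p∈ , _) (inj₁ refl) = p∈
  within-incident⇒∈ (_ , q∈) (inj₂ refl) = q∈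

  walk-source∈ : ∀ {a b vs es} → Walk G a b vs es → a ∈ vs
  walk-source∈ here = here refl
  walk-source∈ (step _ _ _) = here refl

  walk-target∈ : ∀ {a b vs es} → Walk G a b vs es → b ∈ vs
  walk-target∈ here = here refl
  walk-target∈ (step _ _ w) = there (walk-target∈ w)

  walk-edge-ends : ∀ {a b vs es e} → Walk G a b vs es → e ∈ es →
                   ∃₂ λ u w → Joins G e u w × u ∈ vs × w ∈ vs
  walk-edge-ends (step _ j w) (here refl) = _ , _ , j , here refl , there (walk-source∈ w)
  walk-edge-ends (step _ _ w) (there e∈) =
    let u , w' , j , u∈ , w∈ = walk-edge-ends w e∈ in u , w' , j , there u∈ , there w∈

  joins-endpoint∈ : ∀ {e x y u w vs} → Joins G e x y → Joins G e u w → u ∈ vs → w ∈ vs → x ∈ vs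
  joins-endpoint∈ j j' u∈ w∈ with joins-endpoints j j'
  ... | inj₁ (refl , _) = u∈
  ... | inj₂ (refl , _) = w∈

  path-edges-unique : ∀ {a b vs es} → Walk G a b vs es → Unique vs → Unique es
  path-edges-unique here _ = []
  path-edges-unique (step e j w) (a∉ ∷ vs!) = All.tabulate e≢ ∷ path-edges-unique w vs!
    where
    e≢ : ∀ {f} → f ∈ _ → e ≢ f
    e≢ f∈ refl = let _ , _ , j' , u∈ , w∈ = walk-edge-ends w f∈ in All.lookup a∉ (joins-endpoint∈ j j' u∈ w∈) refl

  chord∉path : ∀ {f x y vs es} → Walk G x y vs es → Unique vs → Joins G f x y → 2 ≤ length es → f ∉ es
  chord∉path (step _ j₁ (step _ _ w)) (x∉ ∷ x₁∉ ∷ _) jf _ (here refl) with joins-endpoints jf j₁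
  ... | inj₁ (_ , refl) = All.lookup x₁∉ (walk-target∈ w) refl
  ... | inj₂ (refl , _) = All.lookup x∉ (here refl) refl
  chord∉path (step _ _ here) _ _ (s≤s ()) _
  chord∉path (step _ _ w) (x∉ ∷ _) jf _ (there f∈) =
    let _ , _ , j' , u∈ , w∈ = walk-edge-ends w f∈ in All.lookup x∉ (joins-endpoint∈ jf j' u∈ w∈) refl

  walk-prefix : ∀ {a b vs es y} → Walk G a b vs es → Unique vs → y ∈ vs →
                ∃₂ λ vs' es' → Walk G a y vs' es' × Unique vs' × vs' ⊆ vs × ∃ λ es'' → es ≡ es' ++ es''
  walk-prefix here _ (here refl) = _ , [] , here , [] ∷ [] , id , [] , refl
  walk-prefix {es = es} (step _ _ _) _ (here refl) = _ , [] , here , [] ∷ [] , ∈-∷⁺ʳ (here refl) (λ ()) , es , refl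
  walk-prefix (step e j w) (a∉ ∷ vs!) (there y∈) =
    let vs' , es' , w' , vs'! , vs'⊆ , es'' , es≡ = walk-prefix w vs! y∈
    in _ , e ∷ es' , step e j w' , All.tabulate (All.lookup a∉ ∘ vs'⊆) ∷ vs'! , ∷⁺ʳ _ vs'⊆ , es'' , cong (e ∷_) es≡

module RainbowPaths {n m : ℕ} (G : Graph n m) (c : Fin m → ℕ) where
  open GraphFacts G

  record PathWithin (A : List (Fin n)) (C : List ℕ) (u v : Fin n) (es : List (Fin m)) : Set where
    constructor pathWithin
    field
      {vertices} : List (Fin n)
      walk       : Walk G u v vertices es
      distinct   : Unique vertices
      inside     : vertices ⊆ A
      colours    : map c es ⊆ C
      rainbow    : Rainbow c es
  open PathWithin

  toPath : ∀ {A C u v es} → PathWithin A C u v es → Path G u v es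
  toPath P = vertices P , walk P , distinct P

  trivial : ∀ {A C u} → u ∈ A → PathWithin A C u u []
  trivial u∈ = pathWithin here ([] ∷ []) (λ { (here refl) → u∈ }) (λ ()) []

  widen : ∀ {A C u v es w k} → PathWithin A C u v es → PathWithin (w ∷ A) (k ∷ C) u v es
  widen (pathWithin wk vs! ⊆A ⊆C rb) = pathWithin wk vs! (there ∘ ⊆A) (there ∘ ⊆C) rb

  module _ {A : List (Fin n)} {C : List ℕ} {v : Fin n} {k : ℕ} (v∉ : v ∉ A) (k∉ : k ∉ C) where

    private
      ≢v : ∀ {vs} → vs ⊆ A → All (v ≢_) vs
      ≢v ⊆A = All.tabulate λ { x∈ refl → v∉ (⊆A x∈) }

      ≢k : ∀ {ks} → ks ⊆ C → All (k ≢_) ks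
      ≢k ⊆C = All.tabulate λ { x∈ refl → k∉ (⊆C x∈) }

    prepend : ∀ {p b es e} → Joins G e v p → c e ≡ k → PathWithin A C p b es →
              PathWithin (v ∷ A) (k ∷ C) v b (e ∷ es)
    prepend j refl (pathWithin wk vs! ⊆A ⊆C rb) =
      pathWithin (step _ j wk) (≢v ⊆A ∷ vs!) (∷⁺ʳ v ⊆A) (∷⁺ʳ k ⊆C) (≢k ⊆C ∷ rb)

    append : ∀ {u p es e} → Joins G e p v → c e ≡ k → PathWithin A C u p es →
             PathWithin (v ∷ A) (k ∷ C) u v (es ∷ʳ e)
    append {es = es} {e} j refl (pathWithin wk vs! ⊆A ⊆C rb) =
      pathWithin (walk-∷ʳ wk j) (∷ʳ-unique vs! (≢v ⊆A)) (∷ʳ-⊆ ⊆A)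
                 (subst (_⊆ _) (sym (map-++ c es (e ∷ []))) (∷ʳ-⊆ ⊆C))
                 (subst Unique (sym (map-++ c es (e ∷ []))) (∷ʳ-unique rb (≢k ⊆C)))

    fresh-colour⇒∉ : ∀ {u b es e} → c e ≡ k → PathWithin A C u b es → e ∉ es
    fresh-colour⇒∉ refl P e∈ = k∉ (colours P (∈-map⁺ c e∈))

  nonempty : ∀ {A C u v es} → u ≢ v → PathWithin A C u v es → 0 < length es
  nonempty u≢u (pathWithin here _ _ _ _) = ⊥-elim (u≢u refl)
  nonempty _ (pathWithin (step _ _ _) _ _ _ _) = s≤s z≤n

  record Linkage (A : List (Fin n)) (C : List ℕ) (u a u' b : Fin n) (ℓ : ℕ) : Set where
    constructor linkage
    field
      {Q₁ Q₂}  : List (Fin m)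
      path₁    : PathWithin A C u a Q₁
      path₂    : PathWithin A C u' b Q₂
      disjoint : EdgeDisjoint Q₁ Q₂
      short    : length Q₁ + length Q₂ ≤ ℓ

  Cross : List (Fin n) → List ℕ → Fin n → Fin n → Fin n → Fin n → ℕ → Set
  Cross A C u₁ u₂ a b ℓ = Linkage A C u₁ a u₂ b ℓ ⊎ Linkage A C u₁ b u₂ a ℓ

  fan⇒paths : ∀ {A C u a b ℓ ℓ'} → Linkage A C u a u b ℓ → ℓ ≤ ℓ' →
    Σ (List (Fin m)) λ P₁ → Σ (List (Fin m)) λ P₂ →
      Path G u a P₁ × Path G u b P₂ × Rainbow c P₁ × Rainbow c P₂ × EdgeDisjoint P₁ P₂ ×
      length P₁ + length P₂ ≤ ℓ'
  fan⇒paths (linkage P₁ P₂ d short) ℓ≤ℓ' =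
    _ , _ , toPath P₁ , toPath P₂ , rainbow P₁ , rainbow P₂ , d , ≤-trans short ℓ≤ℓ'

  cross⇒paths : ∀ {A C u₁ u₂ a b ℓ ℓ'} → Cross A C u₁ u₂ a b ℓ → ℓ ≤ ℓ' →
    Σ (List (Fin m)) λ P₁ → Σ (List (Fin m)) λ P₂ →
      ((Path G u₁ a P₁ × Path G u₂ b P₂) ⊎ (Path G u₁ b P₁ × Path G u₂ a P₂)) ×
      Rainbow c P₁ × Rainbow c P₂ × EdgeDisjoint P₁ P₂ × length P₁ + length P₂ ≤ ℓ'
  cross⇒paths (inj₁ (linkage P₁ P₂ d short)) ℓ≤ℓ' =
    _ , _ , inj₁ (toPath P₁ , toPath P₂) , rainbow P₁ , rainbow P₂ , d , ≤-trans short ℓ≤ℓ'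
  cross⇒paths (inj₂ (linkage P₁ P₂ d short)) ℓ≤ℓ' =
    _ , _ , inj₂ (toPath P₁ , toPath P₂) , rainbow P₁ , rainbow P₂ , d , ≤-trans short ℓ≤ℓ'

  module _ {A : List (Fin n)} {C : List ℕ} where

    swap : ∀ {u a u' b ℓ} → Linkage A C u a u' b ℓ → Linkage A C u' b u a ℓ
    swap {ℓ = ℓ} (linkage {Q₁} {Q₂} P₁ P₂ d short) =
      linkage P₂ P₁ (disjoint-sym d) (subst (_≤ ℓ) (+-comm (length Q₁) (length Q₂)) short)

    swap-sources : ∀ {u₁ u₂ a b ℓ} → Cross A C u₁ u₂ a b ℓ → Cross A C u₂ u₁ a b ℓ
    swap-sources = Sum.swap ∘ Sum.map swap swap

    swap-targets : ∀ {u₁ u₂ a b ℓ} → Cross A C u₁ u₂ a b ℓ → Cross A C u₁ u₂ b a ℓ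
    swap-targets = Sum.swap

    widen-linkage : ∀ {u a u' b ℓ w k} → Linkage A C u a u' b ℓ → Linkage (w ∷ A) (k ∷ C) u a u' b (suc ℓ)
    widen-linkage (linkage P₁ P₂ d short) = linkage (widen P₁) (widen P₂) d (m≤n⇒m≤1+n short)

    single-edge-linkage : ∀ {x y u b e Q ℓ} → PathWithin A C x y (e ∷ []) → PathWithin A C u b Q →
                          e ∉ Q → length Q ≤ ℓ → Linkage A C x y u b (suc ℓ)
    single-edge-linkage P₁ P₂ e∉ short = linkage P₁ P₂ (∷-disjoint e∉ []-disjoint) (s≤s short)

  -- ℓ plays the role of |A| − 2.
  record Linked (A : List (Fin n)) (C : List ℕ) (ℓ : ℕ) : Set where
    field
      route : ∀ {u b} → u ∈ A → b ∈ A → u ≢ b →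
              ∃ λ Q → PathWithin A C u b Q × length Q ≤ suc ℓ
      fan   : ∀ {u a b} → u ∈ A → a ∈ A → b ∈ A → u ≢ a → u ≢ b → a ≢ b →
              Linkage A C u a u b (suc ℓ)
      cross : ∀ {u₁ u₂ a b} → u₁ ∈ A → u₂ ∈ A → a ∈ A → b ∈ A →
              u₁ ≢ u₂ → u₁ ≢ a → u₁ ≢ b → u₂ ≢ a → u₂ ≢ b → a ≢ b →
              Cross A C u₁ u₂ a b ℓ

    short-route : ∀ {u b r} → u ∈ A → b ∈ A → r ∈ A → u ≢ b → u ≢ r → b ≢ r →
                  ∃ λ Q → PathWithin A C u b Q × length Q ≤ ℓ
    short-route u∈ b∈ r∈ u≢b u≢r b≢r with fan u∈ b∈ r∈ u≢b u≢r b≢r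
    ... | linkage {Q₁} P₁ P₂ _ short = Q₁ , P₁ , ≤-pred (≤-trans (m<m+n (length Q₁) (nonempty u≢r P₂)) short)

  edge-linked : ∀ {x y e k} → x ≢ y → Joins G e x y → c e ≡ k → Linked (x ∷ y ∷ []) (k ∷ []) 0
  edge-linked {x} {y} {e} {k} x≢y j c≡k = record
    { route = route
    ; fan = λ u∈ a∈ b∈ u≢a u≢b a≢b → ⊥-elim (no-three u∈ a∈ b∈ u≢a u≢b a≢b)
    ; cross = λ u₁∈ _ a∈ b∈ _ u₁≢a u₁≢b _ _ a≢b → ⊥-elim (no-three u₁∈ a∈ b∈ u₁≢a u₁≢b a≢b)
    }
    where
    x∉ : x ∉ y ∷ []
    x∉ (here x≡y) = x≢y x≡y

    route : ∀ {u b} → u ∈ x ∷ y ∷ [] → b ∈ x ∷ y ∷ [] → u ≢ b →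
            ∃ λ Q → PathWithin (x ∷ y ∷ []) (k ∷ []) u b Q × length Q ≤ 1
    route (here refl) (here refl) u≢b = ⊥-elim (u≢b refl)
    route (here refl) (there (here refl)) _ = _ , prepend x∉ (λ ()) j c≡k (trivial (here refl)) , ≤-refl
    route (there (here refl)) (here refl) _ = _ , append x∉ (λ ()) (joins-sym j) c≡k (trivial (here refl)) , ≤-refl
    route (there (here refl)) (there (here refl)) u≢b = ⊥-elim (u≢b refl)

    no-three : ∀ {u a b} → u ∈ x ∷ y ∷ [] → a ∈ x ∷ y ∷ [] → b ∈ x ∷ y ∷ [] → u ≢ a → u ≢ b → a ≢ b → ⊥
    no-three {u} {a} {b} u∈ a∈ b∈ u≢a u≢b a≢b
      with unique⊆⇒length≤ _≟ᶠ_ ((u≢a ∷ u≢b ∷ []) ∷ (a≢b ∷ []) ∷ [] ∷ []) uab⊆xy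
      where
      uab⊆xy : u ∷ a ∷ b ∷ [] ⊆ x ∷ y ∷ []
      uab⊆xy (here refl) = u∈
      uab⊆xy (there (here refl)) = a∈
      uab⊆xy (there (there (here refl))) = b∈
    ... | s≤s (s≤s ())

  record Spoke (A : List (Fin n)) (v : Fin n) (k : ℕ) : Set where
    constructor spoke
    field
      {end}    : Fin n
      edge     : Fin m
      end∈     : end ∈ A
      joins    : Joins G edge v end
      coloured : c edge ≡ k
  open Spoke

  module Extension {A C ℓ v k} (L : Linked A C ℓ) (v∉ : v ∉ A) (k∉ : k ∉ C)
                   (π₁ π₂ : Spoke A v k) (ends≢ : end π₁ ≢ end π₂) where
    open Linked L

    private
      A' : List (Fin n)
      A' = v ∷ A

      C' : List ℕ
      C' = k ∷ C

    spoke-out : (π : Spoke A v k) → PathWithin A' C' v (end π) (edge π ∷ [])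
    spoke-out π = prepend v∉ k∉ (joins π) (coloured π) (trivial (end∈ π))

    spoke-in : (π : Spoke A v k) → PathWithin A' C' (end π) v (edge π ∷ [])
    spoke-in π = append v∉ k∉ (joins-sym (joins π)) (coloured π) (trivial (end∈ π))

    via : ∀ {b Q} (π : Spoke A v k) → PathWithin A C (end π) b Q → PathWithin A' C' v b (edge π ∷ Q)
    via π = prepend v∉ k∉ (joins π) (coloured π)

    into : ∀ {u Q} (π : Spoke A v k) → PathWithin A C u (end π) Q → PathWithin A' C' u v (Q ∷ʳ edge π)
    into π = append v∉ k∉ (joins-sym (joins π)) (coloured π)

    avoids : ∀ {x y Q} (π : Spoke A v k) → PathWithin A C x y Q → edge π ∉ Q
    avoids π = fresh-colour⇒∉ v∉ k∉ (coloured π)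

    spoke-edges-differ : ∀ (π π' : Spoke A v k) → end π ≢ end π' → edge π ≢ edge π'
    spoke-edges-differ π π' π≢π' refl with joins-endpoints (joins π) (joins π')
    ... | inj₁ (_ , π≡π') = π≢π' π≡π'
    ... | inj₂ (v≡π' , _) = v∉ (subst (_∈ A) (sym v≡π') (end∈ π'))

    spoke-edge∉ : ∀ {x y Q} (π π' : Spoke A v k) → end π ≢ end π' → PathWithin A C x y Q → edge π ∉ edge π' ∷ Q
    spoke-edge∉ π π' π≢π' _ (here π≡π') = spoke-edges-differ π π' π≢π' π≡π'
    spoke-edge∉ π _ _ P (there e∈) = avoids π P e∈

    other-spoke : ∀ x → ∃ λ (π : Spoke A v k) → end π ≢ x × (∀ {y} → y ≢ end π₁ → y ≢ end π₂ → y ≢ end π)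
    other-spoke x with end π₁ ≟ᶠ x
    ... | yes refl = π₂ , ≢-sym ends≢ , λ _ y≢π₂ → y≢π₂
    ... | no π₁≢x = π₁ , π₁≢x , λ y≢π₁ _ → y≢π₁

    via₁ : ∀ {a u' b ℓ'} (π : Spoke A v k) → Linkage A C (end π) a u' b ℓ' → Linkage A' C' v a u' b (suc ℓ')
    via₁ π (linkage P₁ P₂ d short) = linkage (via π P₁) (widen P₂) (∷-disjoint (avoids π P₂) d) (s≤s short)

    into₁ : ∀ {u u' b ℓ'} (π : Spoke A v k) → Linkage A C u (end π) u' b ℓ' → Linkage A' C' u v u' b (suc ℓ')
    into₁ {ℓ' = ℓ'} π (linkage {Q₁} {Q₂} P₁ P₂ d short) =
      linkage (into π P₁) (widen P₂) (∷ʳ-disjoint (avoids π P₂) d)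
              (subst (_≤ suc ℓ') (cong (_+ length Q₂) (sym (length-∷ʳ Q₁ (edge π)))) (s≤s short))

    into₂ : ∀ {u a u' ℓ'} (π : Spoke A v k) → Linkage A C u a u' (end π) ℓ' → Linkage A' C' u a u' v (suc ℓ')
    into₂ π = swap ∘ into₁ π ∘ swap

    via-both : ∀ {a b ℓ'} (π π' : Spoke A v k) → end π ≢ end π' → Linkage A C (end π) a (end π') b ℓ' →
               Linkage A' C' v a v b (suc (suc ℓ'))
    via-both {ℓ' = ℓ'} π π' π≢π' (linkage {Q₁} {Q₂} P₁ P₂ d short) =
      linkage (via π P₁) (via π' P₂)
              (∷-disjoint (spoke-edge∉ π π' π≢π' P₂) (disjoint-sym (∷-disjoint (avoids π' P₁) (disjoint-sym d))))
              (s≤s (subst (_≤ suc ℓ') (sym (+-suc (length Q₁) (length Q₂))) (s≤s short)))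

    route' : ∀ {u b} → u ∈ A' → b ∈ A' → u ≢ b → ∃ λ Q → PathWithin A' C' u b Q × length Q ≤ suc (suc ℓ)
    route' (here refl) (here refl) u≢b = ⊥-elim (u≢b refl)
    route' {b = b} (here refl) (there b∈) _ =
      let π , π≢b , _ = other-spoke b
          Q , P , short = route (end∈ π) b∈ π≢b
      in edge π ∷ Q , via π P , s≤s short
    route' {u} (there u∈) (here refl) _ =
      let π , π≢u , _ = other-spoke u
          Q , P , short = route u∈ (end∈ π) (≢-sym π≢u)
      in Q ∷ʳ edge π , into π P , subst (_≤ _) (sym (length-∷ʳ Q (edge π))) (s≤s short)
    route' (there u∈) (there b∈) u≢b =
      let Q , P , short = route u∈ b∈ u≢b in Q , widen P , m≤n⇒m≤1+n short

    fan-along : ∀ {x} (π π' : Spoke A v k) → end π ≢ end π' → x ∈ A → x ≢ end π →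
                Linkage A' C' v (end π) v x (suc (suc ℓ))
    fan-along {x} π π' π≢π' x∈ x≢π with end π' ≟ᶠ x
    ... | yes refl =
      single-edge-linkage (spoke-out π) (spoke-out π') (spoke-edge∉ π π' π≢π' (trivial (end∈ π'))) (s≤s z≤n)
    ... | no π'≢x with short-route (end∈ π') x∈ (end∈ π) π'≢x (≢-sym π≢π') x≢π
    ... | _ , P , short = single-edge-linkage (spoke-out π) (via π' P) (spoke-edge∉ π π' π≢π' P) (s≤s short)

    fan-from-new : ∀ {a b} → a ∈ A → b ∈ A → a ≢ b → Linkage A' C' v a v b (suc (suc ℓ))
    fan-from-new {a} {b} a∈ b∈ a≢b with a ≟ᶠ end π₁ | a ≟ᶠ end π₂ | b ≟ᶠ end π₁ | b ≟ᶠ end π₂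
    ... | yes refl | _ | _ | _ = fan-along π₁ π₂ ends≢ b∈ (≢-sym a≢b)
    ... | no _ | yes refl | _ | _ = fan-along π₂ π₁ (≢-sym ends≢) b∈ (≢-sym a≢b)
    ... | no _ | no _ | yes refl | _ = swap (fan-along π₁ π₂ ends≢ a∈ a≢b)
    ... | no _ | no _ | no _ | yes refl = swap (fan-along π₂ π₁ (≢-sym ends≢) a∈ a≢b)
    ... | no a≢π₁ | no a≢π₂ | no b≢π₁ | no b≢π₂
      with cross (end∈ π₁) (end∈ π₂) a∈ b∈ ends≢ (≢-sym a≢π₁) (≢-sym b≢π₁) (≢-sym a≢π₂) (≢-sym b≢π₂) a≢b
    ... | inj₁ L = via-both π₁ π₂ ends≢ L
    ... | inj₂ L = swap (via-both π₁ π₂ ends≢ L)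

    spoke-in-and-route : ∀ {b} (π : Spoke A v k) → b ∈ A → end π ≢ b →
                         Linkage A' C' (end π) v (end π) b (suc (suc ℓ))
    spoke-in-and-route π b∈ π≢b =
      let _ , P , short = route (end∈ π) b∈ π≢b in single-edge-linkage (spoke-in π) (widen P) (avoids π P) short

    fan-to-new : ∀ {u b} → u ∈ A → b ∈ A → u ≢ b → Linkage A' C' u v u b (suc (suc ℓ))
    fan-to-new {u} {b} u∈ b∈ u≢b with u ≟ᶠ end π₁ | u ≟ᶠ end π₂
    ... | yes refl | _ = spoke-in-and-route π₁ b∈ u≢b
    ... | no _ | yes refl = spoke-in-and-route π₂ b∈ u≢b
    ... | no u≢π₁ | no u≢π₂ =
      let π , π≢b , ≢π = other-spoke b in into₁ π (fan u∈ (end∈ π) b∈ (≢π u≢π₁ u≢π₂) u≢b π≢b)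

    fan' : ∀ {u a b} → u ∈ A' → a ∈ A' → b ∈ A' → u ≢ a → u ≢ b → a ≢ b → Linkage A' C' u a u b (suc (suc ℓ))
    fan' (here refl) (here refl) _ u≢a _ _ = ⊥-elim (u≢a refl)
    fan' (here refl) _ (here refl) _ u≢b _ = ⊥-elim (u≢b refl)
    fan' (here refl) (there a∈) (there b∈) _ _ a≢b = fan-from-new a∈ b∈ a≢b
    fan' (there _) (here refl) (here refl) _ _ a≢b = ⊥-elim (a≢b refl)
    fan' (there u∈) (here refl) (there b∈) _ u≢b _ = fan-to-new u∈ b∈ u≢b
    fan' (there u∈) (there a∈) (here refl) u≢a _ _ = swap (fan-to-new u∈ a∈ u≢a)
    fan' (there u∈) (there a∈) (there b∈) u≢a u≢b a≢b = widen-linkage (fan u∈ a∈ b∈ u≢a u≢b a≢b)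

    spoke-and-short-route : ∀ {x y u b} (π : Spoke A v k) → PathWithin A' C' x y (edge π ∷ []) →
                            u ∈ A → b ∈ A → u ≢ b → u ≢ end π → b ≢ end π → Linkage A' C' x y u b (suc ℓ)
    spoke-and-short-route π S u∈ b∈ u≢b u≢π b≢π =
      let _ , P , short = short-route u∈ b∈ (end∈ π) u≢b u≢π b≢π
      in single-edge-linkage S (widen P) (avoids π P) short

    cross-from-new : ∀ {u₂ a b} → u₂ ∈ A → a ∈ A → b ∈ A → u₂ ≢ a → u₂ ≢ b → a ≢ b → Cross A' C' v u₂ a b (suc ℓ)
    cross-from-new {u₂} {a} {b} u₂∈ a∈ b∈ u₂≢a u₂≢b a≢b with other-spoke u₂
    ... | π , π≢u₂ , _ with end π ≟ᶠ a | end π ≟ᶠ b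
    ... | yes refl | _ = inj₁ (spoke-and-short-route π (spoke-out π) u₂∈ b∈ u₂≢b u₂≢a (≢-sym a≢b))
    ... | no _ | yes refl = inj₂ (spoke-and-short-route π (spoke-out π) u₂∈ a∈ u₂≢a u₂≢b a≢b)
    ... | no π≢a | no π≢b =
      Sum.map (via₁ π) (via₁ π) (cross (end∈ π) u₂∈ a∈ b∈ π≢u₂ π≢a π≢b u₂≢a u₂≢b a≢b)

    cross-to-new : ∀ {u₁ u₂ b} → u₁ ∈ A → u₂ ∈ A → b ∈ A → u₁ ≢ u₂ → u₁ ≢ b → u₂ ≢ b →
                   Cross A' C' u₁ u₂ v b (suc ℓ)
    cross-to-new {u₁} {u₂} {b} u₁∈ u₂∈ b∈ u₁≢u₂ u₁≢b u₂≢b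
      with u₁ ≟ᶠ end π₁ | u₁ ≟ᶠ end π₂ | u₂ ≟ᶠ end π₁ | u₂ ≟ᶠ end π₂
    ... | yes refl | _ | _ | _ =
      inj₁ (spoke-and-short-route π₁ (spoke-in π₁) u₂∈ b∈ u₂≢b (≢-sym u₁≢u₂) (≢-sym u₁≢b))
    ... | no _ | yes refl | _ | _ =
      inj₁ (spoke-and-short-route π₂ (spoke-in π₂) u₂∈ b∈ u₂≢b (≢-sym u₁≢u₂) (≢-sym u₁≢b))
    ... | no _ | no _ | yes refl | _ =
      swap-sources (inj₁ (spoke-and-short-route π₁ (spoke-in π₁) u₁∈ b∈ u₁≢b u₁≢u₂ (≢-sym u₂≢b)))
    ... | no _ | no _ | no _ | yes refl =
      swap-sources (inj₁ (spoke-and-short-route π₂ (spoke-in π₂) u₁∈ b∈ u₁≢b u₁≢u₂ (≢-sym u₂≢b)))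
    ... | no u₁≢π₁ | no u₁≢π₂ | no u₂≢π₁ | no u₂≢π₂ =
      let π , π≢b , ≢π = other-spoke b
      in Sum.map (into₁ π) (into₂ π)
                 (cross u₁∈ u₂∈ (end∈ π) b∈ u₁≢u₂ (≢π u₁≢π₁ u₁≢π₂) u₁≢b (≢π u₂≢π₁ u₂≢π₂) u₂≢b π≢b)

    cross' : ∀ {u₁ u₂ a b} → u₁ ∈ A' → u₂ ∈ A' → a ∈ A' → b ∈ A' →
             u₁ ≢ u₂ → u₁ ≢ a → u₁ ≢ b → u₂ ≢ a → u₂ ≢ b → a ≢ b → Cross A' C' u₁ u₂ a b (suc ℓ)
    cross' (here refl) (here refl) _ _ u₁≢u₂ _ _ _ _ _ = ⊥-elim (u₁≢u₂ refl)
    cross' (here refl) _ (here refl) _ _ u₁≢a _ _ _ _ = ⊥-elim (u₁≢a refl)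
    cross' (here refl) _ _ (here refl) _ _ u₁≢b _ _ _ = ⊥-elim (u₁≢b refl)
    cross' (here refl) (there u₂∈) (there a∈) (there b∈) _ _ _ u₂≢a u₂≢b a≢b =
      cross-from-new u₂∈ a∈ b∈ u₂≢a u₂≢b a≢b
    cross' (there _) (here refl) (here refl) _ _ _ _ u₂≢a _ _ = ⊥-elim (u₂≢a refl)
    cross' (there _) (here refl) _ (here refl) _ _ _ _ u₂≢b _ = ⊥-elim (u₂≢b refl)
    cross' (there u₁∈) (here refl) (there a∈) (there b∈) _ u₁≢a u₁≢b _ _ a≢b =
      swap-sources (cross-from-new u₁∈ a∈ b∈ u₁≢a u₁≢b a≢b)
    cross' (there _) (there _) (here refl) (here refl) _ _ _ _ _ a≢b = ⊥-elim (a≢b refl)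
    cross' (there u₁∈) (there u₂∈) (here refl) (there b∈) u₁≢u₂ _ u₁≢b _ u₂≢b _ =
      cross-to-new u₁∈ u₂∈ b∈ u₁≢u₂ u₁≢b u₂≢b
    cross' (there u₁∈) (there u₂∈) (there a∈) (here refl) u₁≢u₂ u₁≢a _ u₂≢a _ _ =
      swap-targets (cross-to-new u₁∈ u₂∈ a∈ u₁≢u₂ u₁≢a u₂≢a)
    cross' (there u₁∈) (there u₂∈) (there a∈) (there b∈) u₁≢u₂ u₁≢a u₁≢b u₂≢a u₂≢b a≢b =
      Sum.map widen-linkage widen-linkage (cross u₁∈ u₂∈ a∈ b∈ u₁≢u₂ u₁≢a u₁≢b u₂≢a u₂≢b a≢b)

    linked : Linked A' C' (suc ℓ)
    linked = record { route = route' ; fan = fan' ; cross = cross' }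

module RainbowCycles {n m : ℕ} (G : Graph n m) (c : Fin m → ℕ) (simple : Simple G) where
  open GraphFacts G
  open import Data.List.Membership.DecPropositional (_≟ᶠ_ {n}) using (_∈?_)

  no-loop : ∀ {e x} → ¬ Joins G e x x
  no-loop {e} (inj₁ eq) = proj₁ simple e (trans (cong proj₁ eq) (sym (cong proj₂ eq)))
  no-loop {e} (inj₂ eq) = proj₁ simple e (trans (cong proj₁ eq) (sym (cong proj₂ eq)))

  module _ {F : List (Fin m)} (F-rainbow : Rainbow c F) where

    close-cycle : ∀ {x x₀ y vs es f} → Walk G x x₀ vs es → Unique vs → es ⊆ F →
                  f ∈ F → Joins G f x y → head es ≢ just f → y ∈ vs → HasRainbowCycle G c
    close-cycle {f = f} w vs! es⊆F f∈F jf head≢f y∈vs with walk-prefix w vs! y∈vs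
    ... | _ , [] , here , _ = ⊥-elim (no-loop jf)
    ... | _ , _ ∷ [] , step _ je here , _ , _ , _ , refl =
      ⊥-elim (head≢f (cong just (proj₂ simple _ _ _ _ je jf)))
    ... | vs' , es'@(_ ∷ _ ∷ _) , w' , vs'! , _ , _ , refl =
      _ , _ , _ , es' , joins-sym jf , (vs' , w' , vs'!) , s≤s (s≤s (s≤s z≤n)) ,
      unique-map-⊆ c F-rainbow (∈-∷⁺ʳ f∈F (es⊆F ∘ ∈-++⁺ˡ)) (f∉es' ∷ path-edges-unique w' vs'!)
      where
      f∉es' : All (f ≢_) es'
      f∉es' = All.tabulate λ { e∈ refl → chord∉path w' vs'! jf (s≤s (s≤s z≤n)) e∈ }

    module _ {W : List (Fin n)} (within : All (EdgeWithin W) F)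
             (branching : ∀ {x} → x ∈ W → (g : Maybe (Fin m)) → ∃ λ f → f ∈ F × Incident x f × g ≢ just f) where

      -- The walk is stored backwards, from the current vertex x to its start x₀, so head es is
      -- the edge just traversed.
      grow-walk : ∀ fuel {x x₀ vs es} → Walk G x x₀ vs es → Unique vs → vs ⊆ W → es ⊆ F →
                  length W < fuel + length vs → HasRainbowCycle G c
      grow-walk fuel {vs = vs} {es} w vs! vs⊆W es⊆F bound with branching (vs⊆W (walk-source∈ w)) (head es)
      ... | f , f∈F , x~f , head≢f with incident⇒joins x~f
      ... | y , jf with y ∈? vs
      ... | yes y∈vs = close-cycle w vs! es⊆F f∈F jf head≢f y∈vs
      ... | no y∉vs with fuel
      ... | zero = ⊥-elim (<⇒≱ bound (unique⊆⇒length≤ _≟ᶠ_ vs! vs⊆W))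
      ... | suc fuel' =
        grow-walk fuel' (step f (joins-sym jf) w) (All.tabulate (λ { z∈ refl → y∉vs z∈ }) ∷ vs!)
                  (∈-∷⁺ʳ y∈W vs⊆W) (∈-∷⁺ʳ f∈F es⊆F)
                  (subst (length W <_) (sym (+-suc fuel' (length vs))) bound)
        where
        y∈W : y ∈ W
        y∈W = within-incident⇒∈ (All.lookup within f∈F) (proj₂ (joins⇒incident jf))

  degree : Fin n → List (Fin m) → ℕ
  degree x F = length (filter (incident? x) F)

  branching : ∀ {W F} → Unique F → ¬ Any (λ x → degree x F ≤ 1) W →
              ∀ {x} → x ∈ W → (g : Maybe (Fin m)) → ∃ λ f → f ∈ F × Incident x f × g ≢ just f
  branching {W} {F} F! no-leaf {x} x∈W g
    with two-distinct (Unique.filter⁺ (incident? x) F!) (≰⇒> (no-leaf ∘ lose x∈W))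
  ... | g₁ , g₂ , g₁∈ , g₂∈ , g₁≢g₂ =
    let f , f∈ , g≢f = choose g ; f∈F , x~f = ∈-filter⁻ (incident? x) f∈ in f , f∈F , x~f , g≢f
    where
    choose : (g : Maybe (Fin m)) → ∃ λ f → f ∈ filter (incident? x) F × g ≢ just f
    choose nothing = g₁ , g₁∈ , λ ()
    choose (just h) with h ≟ᶠ g₁
    ... | yes refl = g₂ , g₂∈ , g₁≢g₂ ∘ just-injective
    ... | no h≢g₁ = g₁ , g₁∈ , h≢g₁ ∘ just-injective

  record RainbowDense (W : List (Fin n)) (F : List (Fin m)) : Set where
    field
      rainbow  : Rainbow c F
      within   : All (EdgeWithin W) F
      W≤F      : length W ≤ length F
      nonempty : 0 < length F

  delete-leaf : ∀ {W F x} → RainbowDense W F → x ∈ W → degree x F ≤ 1 →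
                RainbowDense (filter (λ y → ¬? (y ≟ᶠ x)) W) (filter (∁? (incident? x)) F)
  delete-leaf {W} {F} {x} D x∈W deg≤1 = record
    { rainbow = unique-map-⊆ c rainbow (filter-⊆ (∁? (incident? x)) F)
                             (Unique.filter⁺ (∁? (incident? x)) (Unique.map⁻ rainbow))
    ; within = All.tabulate within'
    ; W≤F = W'≤F'
    ; nonempty = ≤-trans W'-nonempty W'≤F'
    }
    where
    open RainbowDense D
    ≢x? : ∀ y → Dec (y ≢ x)
    ≢x? y = ¬? (y ≟ᶠ x)

    W' : List (Fin n)
    W' = filter ≢x? W

    F' : List (Fin m)
    F' = filter (∁? (incident? x)) F

    within' : ∀ {e} → e ∈ F' → EdgeWithin W' e
    within' e∈F' =
      let e∈F , x≁e = ∈-filter⁻ (∁? (incident? x)) e∈F'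
          p∈W , q∈W = All.lookup within e∈F
      in ∈-filter⁺ ≢x? p∈W (x≁e ∘ inj₁) , ∈-filter⁺ ≢x? q∈W (x≁e ∘ inj₂)

    W'≤F' : length W' ≤ length F'
    W'≤F' = ≤-pred (begin
      suc (length W')          ≤⟨ length-filter-≢ _≟ᶠ_ x∈W ⟩
      length W                 ≤⟨ W≤F ⟩
      length F                 ≡⟨ sym (length-filter-∁ (incident? x) F) ⟩
      degree x F + length F'   ≤⟨ +-monoˡ-≤ (length F') deg≤1 ⟩
      suc (length F')          ∎)
      where open ≤-Reasoning

    W'-nonempty : 0 < length W'
    W'-nonempty with nonempty⇒∈ nonempty
    ... | f , f∈F with proj₁ (ends G f) ≟ᶠ x | All.lookup within f∈F
    ... | no p≢x | p∈W , _ = ∈-length (∈-filter⁺ ≢x? p∈W p≢x)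
    ... | yes p≡x | _ , q∈W = ∈-length (∈-filter⁺ ≢x? q∈W λ q≡x → proj₁ simple f (trans p≡x (sym q≡x)))

  dense⇒rainbow-cycle : ∀ fuel {W F} → length W ≤ fuel → RainbowDense W F → HasRainbowCycle G c
  dense⇒rainbow-cycle fuel {W} {F} W≤fuel D with any? (λ x → degree x F ≤? 1) W
  ... | yes leaf with find leaf | fuel
  ... | x , x∈W , _ | zero = ⊥-elim (<⇒≱ (∈-length x∈W) W≤fuel)
  ... | x , x∈W , deg≤1 | suc fuel' =
    dense⇒rainbow-cycle fuel' (≤-pred (≤-trans (length-filter-≢ _≟ᶠ_ x∈W) W≤fuel)) (delete-leaf D x∈W deg≤1)
  dense⇒rainbow-cycle fuel {W} {F} W≤fuel D | no no-leaf =
    let f , f∈F = nonempty⇒∈ nonempty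
    in grow-walk rainbow within (branching (Unique.map⁻ rainbow) no-leaf) (length W) here ([] ∷ [])
                 (λ { (here refl) → proj₁ (All.lookup within f∈F) }) (λ ()) (m<m+n (length W) (s≤s z≤n))
    where open RainbowDense D

module Growth (k : ℕ) {m : ℕ} (G : Graph (3 + k) m) (c : Fin m → ℕ) (simple : Simple G)
               (no-rainbow-cycle : ¬ HasRainbowCycle G c)
               (one-of-colour-1 : colourCount c 1 ≡ 1)
               (two-of-each : ∀ i → 2 ≤ i → i ≤ 2 + k → colourCount c i ≡ 2) where

  open GraphFacts G
  open RainbowPaths G c
  open RainbowCycles G c simple
  open import Data.List.Membership.DecPropositional (_≟ᶠ_ {3 + k}) using (_∈?_)

  private
    n : ℕ
    n = 3 + k

  colourClass : ℕ → List (Fin m)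
  colourClass i = filter (λ e → c e ≟ℕ i) (allFin m)

  ∈-colourClass⁻ : ∀ {e i} → e ∈ colourClass i → c e ≡ i
  ∈-colourClass⁻ {i = i} e∈ = proj₂ (∈-filter⁻ (λ e → c e ≟ℕ i) {xs = allFin m} e∈)

  colour-pair : ∀ {i} → 2 ≤ i → i ≤ 2 + k → ∃₂ λ a b → colourClass i ≡ a ∷ b ∷ [] × a ≢ b
  colour-pair {i} 2≤i i≤
    with colourClass i | Unique.filter⁺ (λ e → c e ≟ℕ i) (Unique.allFin⁺ m) | two-of-each i 2≤i i≤
  ... | a ∷ b ∷ [] | (a≢b ∷ _) ∷ _ | _ = a , b , refl , a≢b

  record Centre (v : Fin n) (i : ℕ) : Set where
    field
      2≤i      : 2 ≤ i
      i≤2+k    : i ≤ 2 + k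
      incident : All (Incident v) (colourClass i)
  open Centre

  centre-unique : ∀ {v w i} → Centre v i → Centre w i → v ≡ w
  centre-unique {v} {w} Cv Cw with v ≟ᶠ w | colour-pair (2≤i Cv) (i≤2+k Cv)
  ... | yes v≡w | _ = v≡w
  ... | no v≢w | a , b , eq , a≢b
    with subst (All (Incident v)) eq (incident Cv) | subst (All (Incident w)) eq (incident Cw)
  ... | v~a ∷ v~b ∷ [] | w~a ∷ w~b ∷ [] =
    ⊥-elim (a≢b (proj₂ simple a b v w (incidents⇒joins v~a w~a v≢w) (incidents⇒joins v~b w~b v≢w)))

  record Cherry (v : Fin n) : Set where
    field
      colour              : ℕ
      centre              : Centre v colour
      {p q}               : Fin n
      edge₁ edge₂         : Fin m
      joins₁              : Joins G edge₁ v p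
      joins₂              : Joins G edge₂ v q
      coloured₁           : c edge₁ ≡ colour
      coloured₂           : c edge₂ ≡ colour
      p≢q                 : p ≢ q

  centre⇒cherry : ∀ {v i} → Centre v i → Cherry v
  centre⇒cherry {v} {i} C with colour-pair (2≤i C) (i≤2+k C)
  ... | a , b , eq , a≢b with subst (All (Incident v)) eq (incident C)
  ... | v~a ∷ v~b ∷ [] with incident⇒joins v~a | incident⇒joins v~b
  ... | p , ja | q , jb = record
    { colour = i ; centre = C ; edge₁ = a ; edge₂ = b ; joins₁ = ja ; joins₂ = jb
    ; coloured₁ = ∈-colourClass⁻ (subst (a ∈_) (sym eq) (here refl))
    ; coloured₂ = ∈-colourClass⁻ (subst (b ∈_) (sym eq) (there (here refl)))
    ; p≢q = λ { refl → a≢b (proj₂ simple a b v p ja jb) }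
    }

  colour-1-edge : ∃ λ e → e ∈ colourClass 1
  colour-1-edge = nonempty⇒∈ {xs = colourClass 1} (subst (0 <_) (sym one-of-colour-1) ≤-refl)

  e₀ : Fin m
  e₀ = proj₁ colour-1-edge

  c[e₀]≡1 : c e₀ ≡ 1
  c[e₀]≡1 = ∈-colourClass⁻ (proj₂ colour-1-edge)

  no-centre⇒rainbow-cycle : ∀ v → ¬ Incident v e₀ →
                            ((j : Fin (suc k)) → ∃ λ e → c e ≡ 2 + toℕ j × ¬ Incident v e) → HasRainbowCycle G c
  no-centre⇒rainbow-cycle v v≁e₀ avoiding = dense⇒rainbow-cycle (length W) ≤-refl dense
    where

    F : List (Fin m)
    F = e₀ ∷ tabulate (proj₁ ∘ avoiding)

    ≢v? : ∀ y → Dec (y ≢ v)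
    ≢v? y = ¬? (y ≟ᶠ v)

    W : List (Fin n)
    W = filter ≢v? (allFin n)

    avoids-v : All (λ e → ¬ Incident v e) F
    avoids-v = v≁e₀ ∷ Allₚ.tabulate⁺ (proj₂ ∘ proj₂ ∘ avoiding)

    rainbow : Rainbow c F
    rainbow = Allₚ.map⁺ (Allₚ.tabulate⁺ λ j c₀≡ → 1≢2+ j (trans (sym c[e₀]≡1) (trans c₀≡ (colour j))))
            ∷ subst Unique (sym (map-tabulate (proj₁ ∘ avoiding) c))
                (Unique.tabulate⁺ λ {i} {j} eq →
                   toℕ-injective (+-cancelˡ-≡ 2 _ _ (trans (sym (colour i)) (trans eq (colour j)))))
      where
      colour : ∀ j → c (proj₁ (avoiding j)) ≡ 2 + toℕ j
      colour = proj₁ ∘ proj₂ ∘ avoiding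
      1≢2+ : ∀ j → 1 ≢ 2 + toℕ j
      1≢2+ _ ()

    dense : RainbowDense W F
    dense = record
      { rainbow = rainbow
      ; within = All.map (λ v≁e → ∈-filter⁺ ≢v? (∈-allFin _) (v≁e ∘ inj₁) , ∈-filter⁺ ≢v? (∈-allFin _) (v≁e ∘ inj₂))
                         avoids-v
      ; W≤F = subst (length W ≤_) (cong suc (sym (length-tabulate (proj₁ ∘ avoiding))))
                (≤-pred (subst (length W <_) (length-tabulate id) (length-filter-≢ _≟ᶠ_ (∈-allFin v))))
      ; nonempty = s≤s z≤n
      }

  has-centre : ∀ v → ¬ Incident v e₀ → ∃ (Centre v)
  has-centre v v≁e₀ with anyᶠ? (λ j → all? (incident? v) (colourClass (2 + toℕ j)))
  ... | yes (j , v~all) = 2 + toℕ j , record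
    { 2≤i = s≤s (s≤s z≤n) ; i≤2+k = s≤s (s≤s (≤-pred (toℕ<n j))) ; incident = v~all }
  ... | no none = ⊥-elim (no-rainbow-cycle (no-centre⇒rainbow-cycle v v≁e₀ avoiding))
    where
    avoiding : (j : Fin (suc k)) → ∃ λ e → c e ≡ 2 + toℕ j × ¬ Incident v e
    avoiding j =
      let e , e∈ , v≁e = find (¬All⇒Any¬ (incident? v) _ (λ v~all → none (j , v~all)))
      in e , ∈-colourClass⁻ e∈ , v≁e

  x₀ y₀ : Fin n
  x₀ = proj₁ (ends G e₀)
  y₀ = proj₂ (ends G e₀)

  record Stage : Set where
    field
      A        : List (Fin n)
      C        : List ℕ
      ℓ        : ℕ
      distinct : Unique A
      size     : length A ≡ 2 + ℓ
      x₀∈A     : x₀ ∈ A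
      y₀∈A     : y₀ ∈ A
      linked   : Linked A C ℓ
      colours  : ∀ {i} → i ∈ C → i ≡ 1 ⊎ ∃ λ w → w ∈ A × Centre w i

  initial : Stage
  initial = record
    { A = x₀ ∷ y₀ ∷ [] ; C = 1 ∷ [] ; ℓ = 0
    ; distinct = (proj₁ simple e₀ ∷ []) ∷ [] ∷ [] ; size = refl
    ; x₀∈A = here refl ; y₀∈A = there (here refl)
    ; linked = edge-linked (proj₁ simple e₀) (inj₁ refl) c[e₀]≡1
    ; colours = λ { (here refl) → inj₁ refl }
    }

  ExitEdge : List (Fin n) → Fin n → Set
  ExitEdge A w = ∃₂ λ r g → Joins G g w r × r ∉ A × Centre w (c g)

  module _ (s : Stage) where
    open Stage s

    fits : length A ≤ n
    fits = subst (length A ≤_) (length-tabulate id) (unique⊆⇒length≤ _≟ᶠ_ distinct (λ _ → ∈-allFin _))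

    outside⇒off-e₀ : ∀ {v} → v ∉ A → ¬ Incident v e₀
    outside⇒off-e₀ v∉A (inj₁ refl) = v∉A x₀∈A
    outside⇒off-e₀ v∉A (inj₂ refl) = v∉A y₀∈A

    record Attachment : Set where
      field
        v      : Fin n
        v∉A    : v ∉ A
        cherry : Cherry v
        p∈A    : Cherry.p cherry ∈ A
        q∈A    : Cherry.q cherry ∈ A

    attach : Attachment → Stage
    attach a = record
      { A = v ∷ A ; C = colour ∷ C ; ℓ = suc ℓ
      ; distinct = All.tabulate (λ { w∈A refl → v∉A w∈A }) ∷ distinct
      ; size = cong suc size
      ; x₀∈A = there x₀∈A ; y₀∈A = there y₀∈A
      ; linked = Extension.linked linked v∉A colour∉C
                   (spoke edge₁ p∈A joins₁ coloured₁) (spoke edge₂ q∈A joins₂ coloured₂) p≢q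
      ; colours = λ { (here refl) → inj₂ (v , here refl , centre)
                    ; (there i∈C) → Sum.map₂ (λ (w , w∈A , Cw) → w , there w∈A , Cw) (colours i∈C) }
      }
      where
      open Attachment a
      open Cherry cherry
      colour∉C : colour ∉ C
      colour∉C i∈C with colours i∈C
      ... | inj₁ refl with 2≤i centre
      ... | s≤s ()
      colour∉C i∈C | inj₂ (w , w∈A , Cw) = v∉A (subst (_∈ A) (centre-unique Cw centre) w∈A)

    attach-or-exit : ∀ {v} → v ∉ A → Attachment ⊎ ExitEdge A v
    attach-or-exit {v} v∉A with centre⇒cherry (proj₂ (has-centre v (outside⇒off-e₀ v∉A)))
    ... | ch with Cherry.p ch ∈? A | Cherry.q ch ∈? A
    ... | yes p∈A | yes q∈A = inj₁ (record { v = v ; v∉A = v∉A ; cherry = ch ; p∈A = p∈A ; q∈A = q∈A })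
    ... | no p∉A | _ = inj₂ (_ , _ , joins₁ , p∉A , subst (Centre v) (sym coloured₁) centre)
      where open Cherry ch
    ... | yes _ | no q∉A = inj₂ (_ , _ , joins₂ , q∉A , subst (Centre v) (sym coloured₂) centre)
      where open Cherry ch

    search : ∀ vs → Attachment ⊎ (∀ {w} → w ∈ vs → w ∉ A → ExitEdge A w)
    search [] = inj₂ λ ()
    search (v ∷ vs) with v ∈? A
    ... | yes v∈A =
      Sum.map₂ (λ exits → λ { (here refl) v∉A → ⊥-elim (v∉A v∈A) ; (there w∈) → exits w∈ }) (search vs)
    ... | no v∉A with attach-or-exit v∉A
    ... | inj₁ a = inj₁ a
    ... | inj₂ exit = Sum.map₂ (λ exits → λ { (here refl) _ → exit ; (there w∈) → exits w∈ }) (search vs)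

    module _ (exit : ∀ {w} → w ∉ A → ExitEdge A w) where

      private
        ∉A? : ∀ v → Dec (v ∉ A)
        ∉A? v = ¬? (v ∈? A)

        R : List (Fin n)
        R = filter ∉A? (allFin n)

      exit-edges : ∀ S → Unique S → S ⊆ R →
                   ∃ λ F → length F ≡ length S × All (EdgeWithin R) F × Rainbow c F ×
                           All (λ e → ∃ λ w → w ∈ S × Centre w (c e)) F
      exit-edges [] _ _ = [] , refl , [] , [] , []
      exit-edges (w ∷ S) (w∉S ∷ S!) S⊆R
        with exit-edges S S! (S⊆R ∘ there) | exit (proj₂ (∈-filter⁻ ∉A? (S⊆R (here refl))))
      ... | F , |F| , within , rainbow , centres | r , g , jg , r∉A , Cw =
        g ∷ F , cong suc |F| , joins⇒within jg (S⊆R (here refl)) (∈-filter⁺ ∉A? (∈-allFin r) r∉A) ∷ within ,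
        Allₚ.map⁺ (All.map (λ (w' , w'∈S , Cw') c≡ →
                              All.lookup w∉S w'∈S (centre-unique Cw (subst (Centre w') (sym c≡) Cw')))
                           centres)
          ∷ rainbow ,
        (w , here refl , Cw) ∷ All.map (λ (w' , w'∈S , Cw') → w' , there w'∈S , Cw') centres

      exits⇒rainbow-cycle : ∀ {w₀} → w₀ ∉ A → HasRainbowCycle G c
      exits⇒rainbow-cycle w₀∉A =
        let F , |F| , within , rainbow , _ = exit-edges R (Unique.filter⁺ ∉A? (Unique.allFin⁺ n)) id
        in dense⇒rainbow-cycle (length R) ≤-refl record
          { rainbow = rainbow ; within = within ; W≤F = ≤-reflexive (sym |F|)
          ; nonempty = subst (0 <_) (sym |F|) (∈-length (∈-filter⁺ ∉A? (∈-allFin _) w₀∉A)) }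

  grow : ∀ fuel (s : Stage) → n < fuel + length (Stage.A s) → ∃ λ (s : Stage) → ∀ v → v ∈ Stage.A s
  grow fuel s bound with allᶠ? (_∈? Stage.A s)
  ... | yes covered = s , covered
  ... | no uncovered with search s (allFin n)
  ... | inj₂ exits =
    ⊥-elim (no-rainbow-cycle
      (exits⇒rainbow-cycle s (exits (∈-allFin _)) (proj₂ (¬∀⟶∃¬ n _ (_∈? Stage.A s) uncovered))))
  ... | inj₁ a with fuel
  ... | zero = ⊥-elim (<⇒≱ bound (fits s))
  ... | suc fuel' = grow fuel' (attach s a) (subst (n <_) (sym (+-suc fuel' _)) bound)

  fully-linked : ∃₂ λ A C → ∃ λ ℓ → Linked A C ℓ × (∀ v → v ∈ A) × 2 + ℓ ≤ n
  fully-linked with grow n initial (m<m+n n (s≤s z≤n))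
  ... | s , covered = A , C , ℓ , linked , covered , subst (_≤ n) size (fits s)
    where open Stage s

lemma4 : (n m : ℕ) → 3 ≤ n → m ≡ 2 * n ∸ 3 →
    (G : Graph n m) → Simple G → Connected G →
    (c : Fin m → ℕ) →
    (∀ e → 1 ≤ c e × c e ≤ n ∸ 1) →
    colourCount c 1 ≡ 1 →
    (∀ i → 2 ≤ i → i ≤ n ∸ 1 → colourCount c i ≡ 2) →
    ¬ HasRainbowCycle G c →
    (u₁ u₂ u₁' u₂' : Fin n) →
    u₁ ≢ u₁' → u₁ ≢ u₂' → u₂ ≢ u₁' → u₂ ≢ u₂' → u₁' ≢ u₂' →
    (u₁ ≡ u₂ →
      Σ (List (Fin m)) λ P₁ → Σ (List (Fin m)) λ P₂ →
        Path G u₁ u₁' P₁ × Path G u₁ u₂' P₂ ×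
        Rainbow c P₁ × Rainbow c P₂ × EdgeDisjoint P₁ P₂ ×
        length P₁ + length P₂ ≤ n ∸ 1)
    ×
    (u₁ ≢ u₂ →
      Σ (List (Fin m)) λ P₁ → Σ (List (Fin m)) λ P₂ →
        ((Path G u₁ u₁' P₁ × Path G u₂ u₂' P₂) ⊎
         (Path G u₁ u₂' P₁ × Path G u₂ u₁' P₂)) ×
        Rainbow c P₁ × Rainbow c P₂ × EdgeDisjoint P₁ P₂ ×
        length P₁ + length P₂ ≤ n ∸ 2)
lemma4 (suc (suc (suc k))) m (s≤s (s≤s (s≤s z≤n))) _ G simple _ c _ one-of-colour-1 two-of-each no-rainbow-cycle
       u₁ u₂ u₁' u₂' u₁≢u₁' u₁≢u₂' u₂≢u₁' u₂≢u₂' u₁'≢u₂'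
  with Growth.fully-linked k G c simple no-rainbow-cycle one-of-colour-1 two-of-each
... | A , C , ℓ , L , covered , 2+ℓ≤n =
  (λ { refl → fan⇒paths (fan (covered u₁) (covered u₁') (covered u₂') u₁≢u₁' u₁≢u₂' u₁'≢u₂') (≤-pred 2+ℓ≤n) }) ,
  (λ u₁≢u₂ → cross⇒paths (cross (covered u₁) (covered u₂) (covered u₁') (covered u₂')
                                 u₁≢u₂ u₁≢u₁' u₁≢u₂' u₂≢u₁' u₂≢u₂' u₁'≢u₂')
                          (≤-pred (≤-pred 2+ℓ≤n)))
  where
  open RainbowPaths G c
  open Linked L
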